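{- Let $k\geq 3$ and let $S_k$ be the sun graph on $n=2k$ vertices: take a cycle $v_1v_2\cdots v_kv_1$ and add vertices $u_1,\ldots,u_k$ where $u_i$ is adjacent exactly to $v_i$ and $v_{i+1}$ (indices modulo $k$). Then $Z(S_k)=n_\ell=k=\frac{n}{2}$, where $n_\ell$ is the number of leaves of the weak dual of $S_k$.
   Context: $Z(G)$ is the zero forcing number: each vertex is blue or white; if a blue vertex $u$ has exactly one white neighbor $v$, then $v$ turns blue; a zero forcing set is an initial blue set that eventually makes all vertices blue, and $Z(G)$ is the minimum size of such a set. The weak dual of an outerplanar graph (with a fixed outerplanar embedding) has the bounded faces as vertices, two adjacent when they share an edge. -}

module Defs where

open import Data.Nat using (ℕ; zero; suc; _≤_; _<?_)
open import Data.Fin using (Fin; zero; suc; toℕ; fromℕ<; _↑ˡ_; _↑ʳ_; splitAt)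
open import Data.Fin.Subset using (Subset; _∈_; ∣_∣)
open import Data.List using (List; []; _∷_; _++_; [_]; map)
open import Data.Product using (Σ; _×_; _,_; ∃)
open import Data.Sum using (_⊎_; inj₁; inj₂)
open import Relation.Nullary using (¬_; yes; no)
open import Relation.Binary.PropositionalEquality using (_≡_)
open import Function using (_⇔_)

record Graph (n : ℕ) : Set₁ where
  field
    Adj : Fin n → Fin n → Set
open Graph public

-- Blue G S v : vertex v eventually becomes blue when S is initially blue.

data Blue {n : ℕ} (G : Graph n) (S : Subset n) : Fin n → Set where
  initial : ∀ {v} → v ∈ S → Blue G S v
  force   : ∀ {u v} → Blue G S u → Adj G u v →
            (∀ w → Adj G u w → ¬ (w ≡ v) → Blue G S w) → Blue G S v

ZeroForcingSet : {n : ℕ} → Graph n → Subset n → Set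
ZeroForcingSet G S = ∀ v → Blue G S v

IsZeroForcingNumber : {n : ℕ} → Graph n → ℕ → Set
IsZeroForcingNumber {n} G m =
  (Σ (Subset n) λ S → ZeroForcingSet G S × ∣ S ∣ ≡ m) ×
  (∀ (S : Subset n) → ZeroForcingSet G S → m ≤ ∣ S ∣)

-- Plane embeddings given by their bounded faces: each bounded face is
-- given by its boundary walk (cyclic list of vertices).

record BoundedFaces (n : ℕ) : Set where
  field
    F        : ℕ
    boundary : Fin F → List (Fin n)
open BoundedFaces public

data Consec {A : Set} : List A → A → A → Set where
  here  : ∀ {x y rest} → Consec (x ∷ y ∷ rest) x y
  there : ∀ {x y z rest} → Consec rest y z → Consec (x ∷ rest) y z

CycEdge : {A : Set} → List A → A → A → Set
CycEdge [] a b = Data.Empty.⊥ where import Data.Empty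
CycEdge (x ∷ xs) a b =
  Consec ((x ∷ xs) ++ [ x ]) a b ⊎ Consec ((x ∷ xs) ++ [ x ]) b a

WeakDual : {n : ℕ} → Graph n → (E : BoundedFaces n) → Graph (F E)
WeakDual G E = record
  { Adj = λ f g → ¬ (f ≡ g) × (Σ _ λ a → Σ _ λ b →
            Adj G a b × CycEdge (boundary E f) a b × CycEdge (boundary E g) a b) }

IsLeaf : {m : ℕ} → Graph m → Fin m → Set
IsLeaf {m} H f = Σ (Fin m) λ g → Adj H f g × (∀ h → Adj H f h → h ≡ g)

NumLeaves : {m : ℕ} → Graph m → ℕ → Set
NumLeaves {m} H ℓ = Σ (Subset m) λ L → (∀ f → (f ∈ L ⇔ IsLeaf H f)) × ∣ L ∣ ≡ ℓ

-- Sun graph S_k on Fin (k + k):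
--   v i = i ↑ˡ k   (cycle vertices, 0-based), u i = k ↑ʳ i (pendant-triangle vertices).

csuc : {k : ℕ} → Fin k → Fin k
csuc {suc m} i with suc (toℕ i) <? suc m
... | yes p = fromℕ< p
... | no _  = zero

vtx : {k : ℕ} → Fin k → Fin (k Data.Nat.+ k)
vtx {k} i = i ↑ˡ k

utx : {k : ℕ} → Fin k → Fin (k Data.Nat.+ k)
utx {k} i = k ↑ʳ i

SunAdj : (k : ℕ) → Fin (k Data.Nat.+ k) → Fin (k Data.Nat.+ k) → Set
SunAdj k a b with splitAt k a | splitAt k b
... | inj₁ i | inj₁ j = (j ≡ csuc i) ⊎ (i ≡ csuc j)
... | inj₁ i | inj₂ j = (i ≡ j) ⊎ (i ≡ csuc j)
... | inj₂ i | inj₁ j = (j ≡ i) ⊎ (j ≡ csuc i)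
... | inj₂ i | inj₂ j = Data.Empty.⊥ where import Data.Empty

Sun : (k : ℕ) → Graph (k Data.Nat.+ k)
Sun k = record { Adj = SunAdj k }

-- The outerplanar embedding of S_k: bounded faces are the inner k-cycle
-- (face zero) and the triangles v_i u_i v_{i+1} (face suc i).
SunFaces : (k : ℕ) → BoundedFaces (k Data.Nat.+ k)
SunFaces k = record { F = suc k ; boundary = bd }
  where
  bd : Fin (suc k) → List (Fin (k Data.Nat.+ k))
  bd zero    = map vtx (Data.List.tabulate {n = k} (λ i → i))
  bd (suc i) = vtx i ∷ utx i ∷ vtx (csuc i) ∷ []

-- Upper bound: S₀ = {v₁, u₁, …, u_{k−1}} is zero forcing, since u_t forces v_{t+1} for
-- t = 1, …, k−1 and then v₀ forces u₀.
--
-- Lower bound: call F a fort if no vertex outside F has exactly one neighbour in F. If no vertex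
-- of F is blue initially, none ever becomes blue, so every zero forcing set S meets every fort.
-- For q < P the arc {u_q, v_{q+1}, …, v_P, u_P} (indices mod k) is a fort; hence between any two
-- tips missing from S there is a cycle vertex of S. Charging each missing tip to such a cycle
-- vertex on the arc before it gives ∣S∣ ≥ k.
--
-- Weak dual: the inner k-cycle shares a rim edge with every triangle, while for k ≥ 3 no two
-- triangles share an edge, so the weak dual is a star with k leaves.

module Submission where

open import Defs
open import Data.Nat using (ℕ; zero; suc; _+_; _/_; _≤_; _<_; _<?_; z≤n; s≤s; s≤s⁻¹; s<s⁻¹)
open import Data.Nat.Properties
  using ( module ≤-Reasoning; 1+n≢n; 1+n≢0; >⇒≢; <⇒≤; <⇒≱; ≤-refl; ≤-trans; <-irrefl; <-trans
        ; n<1+n; m<n⇒m<1+n; m≤n⇒m<n∨m≡n; m≤n+m; +-mono-≤; +-comm; +-suc; +-identityʳ; +-cancelˡ-≡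
        ; *-comm; +-0-commutativeMonoid )
  renaming (suc-injective to ℕ-suc-injective)
open import Data.Nat.DivMod using (m*n/n≡m)
open import Algebra.Properties.CommutativeMonoid.Sum +-0-commutativeMonoid
  using (sum; sum-syntax; sum-cong-≗; sum-init-last; ∑-distrib-+)
open import Data.Bool using (Bool; true; false; _∨_; _≟_)
open import Data.Bool.Properties using (∨-conicalˡ; ∨-conicalʳ; ¬-not)
open import Data.Fin using (Fin; zero; suc; toℕ; fromℕ; inject₁; _↑ˡ_; _↑ʳ_; splitAt)
open import Data.Fin.Properties
  using ( toℕ-injective; toℕ-fromℕ; toℕ-fromℕ<; toℕ-inject₁; toℕ<n; any?
        ; splitAt-↑ˡ; splitAt-↑ʳ; splitAt⁻¹-↑ˡ; splitAt⁻¹-↑ʳ; ↑ˡ-injective; ↑ʳ-injective )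
  renaming (suc-injective to Fin-suc-injective)
open import Data.Fin.Relation.Unary.Top using (view; ‵fromℕ; ‵inject₁)
open import Data.Fin.Subset using (Subset; _∈_; _∉_; ∣_∣; ⊤; ⁅_⁆; inside; outside)
open import Data.Fin.Subset.Properties using (∈⊤; x∈⁅x⁆; ∣⊤∣≡n; ∣⁅x⁆∣≡1)
open import Data.Vec using ([]; _∷_; _++_; lookup; here; there)
open import Data.Vec.Properties using ([]=⇒lookup)
open import Data.List using (tabulate; [_]) renaming (_++_ to _++ₗ_)
open import Data.List.Properties using (map-tabulate)
open import Data.Product using (Σ; ∃-syntax; _×_; _,_)
open import Data.Sum using (_⊎_; inj₁; inj₂)
open import Data.Empty using (⊥; ⊥-elim)
open import Function using (_∘_; _∘′_; mk⇔)
open import Relation.Nullary using (¬_; yes; no)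
open import Relation.Binary.PropositionalEquality hiding ([_])

module _ {n : ℕ} where

  csuc-fromℕ : csuc (fromℕ n) ≡ zero
  csuc-fromℕ with suc (toℕ (fromℕ n)) <? suc n
  ... | yes p = ⊥-elim (<-irrefl (cong suc (toℕ-fromℕ n)) p)
  ... | no _  = refl

  csuc-inject₁ : (i : Fin n) → csuc (inject₁ i) ≡ suc i
  csuc-inject₁ i with suc (toℕ (inject₁ i)) <? suc n
  ... | yes p = toℕ-injective (trans (toℕ-fromℕ< p) (cong suc (toℕ-inject₁ i)))
  ... | no ¬p = ⊥-elim (¬p (s≤s (subst (_< n) (sym (toℕ-inject₁ i)) (toℕ<n i))))

  csuc-increments-or-wraps : (i : Fin (suc n)) →
                             (toℕ (csuc i) ≡ suc (toℕ i)) ⊎ (i ≡ fromℕ n × csuc i ≡ zero)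
  csuc-increments-or-wraps i with view i
  ... | ‵fromℕ     = inj₂ (refl , csuc-fromℕ)
  ... | ‵inject₁ j = inj₁ (trans (cong toℕ (csuc-inject₁ j)) (cong suc (sym (toℕ-inject₁ j))))

  csuc-injective : {i j : Fin (suc n)} → csuc i ≡ csuc j → i ≡ j
  csuc-injective {i} {j} eq with view i | view j
  ... | ‵fromℕ     | ‵fromℕ     = refl
  ... | ‵fromℕ     | ‵inject₁ b with () ← trans (sym csuc-fromℕ) (trans eq (csuc-inject₁ b))
  ... | ‵inject₁ a | ‵fromℕ     with () ← trans (sym csuc-fromℕ) (trans (sym eq) (csuc-inject₁ a))
  ... | ‵inject₁ a | ‵inject₁ b =
    cong inject₁ (Fin-suc-injective (trans (sym (csuc-inject₁ a)) (trans eq (csuc-inject₁ b))))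

csuc-irreflexive : ∀ {n} (i : Fin (suc (suc n))) → csuc i ≢ i
csuc-irreflexive i eq with csuc-increments-or-wraps i
... | inj₁ step            = 1+n≢n (trans (sym step) (cong toℕ eq))
... | inj₂ (refl , wraps) with () ← trans (sym wraps) eq

-- Two steps wrap around at most once, and a wrap at either step would force k ≤ 2.
csuc²-irreflexive : ∀ {n} (i : Fin (suc (suc (suc n)))) → csuc (csuc i) ≢ i
csuc²-irreflexive i eq with csuc-increments-or-wraps i | csuc-increments-or-wraps (csuc i)
... | inj₂ (refl , wraps) | _
  with () ← Fin-suc-injective (trans (sym (csuc-inject₁ zero)) (trans (sym (cong csuc wraps)) eq))
... | inj₁ step | inj₁ step′ =
  >⇒≢ (m<n⇒m<1+n (n<1+n (toℕ i))) (trans (cong suc (sym step)) (trans (sym step′) (cong toℕ eq)))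
... | inj₁ step | inj₂ (top , wraps) =
  1+n≢0 (ℕ-suc-injective (trans (sym (cong toℕ top)) (trans step (cong (suc ∘ toℕ) i≡0))))
  where
  i≡0 : i ≡ zero
  i≡0 = trans (sym eq) wraps

-- pos a is a mod (suc n), defined by iteration so that pos (suc a) = csuc (pos a) by definition.
pos : ∀ {n} → ℕ → Fin (suc n)
pos zero    = zero
pos (suc a) = csuc (pos a)

toℕ-pos : ∀ {n a} → a < suc n → toℕ (pos {n} a) ≡ a
toℕ-pos {a = zero}  _  = refl
toℕ-pos {n} {suc a} lt with csuc-increments-or-wraps (pos {n} a)
... | inj₁ step       = trans step (cong suc (toℕ-pos (<-trans (n<1+n a) lt)))
... | inj₂ (top , _) = ⊥-elim (<-irrefl a≡n (s<s⁻¹ lt))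
  where
  a≡n : a ≡ n
  a≡n = trans (sym (toℕ-pos (<-trans (n<1+n a) lt))) (trans (cong toℕ top) (toℕ-fromℕ n))

pos-toℕ : ∀ {n} (i : Fin (suc n)) → pos (toℕ i) ≡ i
pos-toℕ i = toℕ-injective (toℕ-pos (toℕ<n i))

pos-fromℕ : ∀ n → pos n ≡ fromℕ n
pos-fromℕ n = toℕ-injective (trans (toℕ-pos (n<1+n n)) (sym (toℕ-fromℕ n)))

pos-periodic : ∀ {n} a → pos {n} (a + suc n) ≡ pos a
pos-periodic {n} zero    = trans (cong csuc (pos-fromℕ n)) csuc-fromℕ
pos-periodic     (suc a) = cong csuc (pos-periodic a)

∑-rotate₁ : ∀ n (f : ℕ → ℕ) → f n ≡ f 0 → ∑[ i < n ] f (suc (toℕ i)) ≡ ∑[ i < n ] f (toℕ i)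
∑-rotate₁ n f fn≡f0 = +-cancelˡ-≡ (f 0) _ _ (begin
  f 0 + ∑[ i < n ] f (suc (toℕ i))                   ≡⟨ sum-init-last {n} (f ∘′ toℕ) ⟩
  ∑[ i < n ] f (toℕ (inject₁ i)) + f (toℕ (fromℕ n)) ≡⟨ cong₂ _+_ init≡ last≡ ⟩
  ∑[ i < n ] f (toℕ i) + f 0                         ≡⟨ +-comm _ (f 0) ⟩
  f 0 + ∑[ i < n ] f (toℕ i)                         ∎)
  where
  open ≡-Reasoning
  init≡ : ∑[ i < n ] f (toℕ (inject₁ i)) ≡ ∑[ i < n ] f (toℕ i)
  init≡ = sum-cong-≗ {n} (λ i → cong f (toℕ-inject₁ i))
  last≡ : f (toℕ (fromℕ n)) ≡ f 0
  last≡ = trans (cong f (toℕ-fromℕ n)) fn≡f0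

∑-periodic : ∀ n (h : ℕ → ℕ) → (∀ s → h (s + n) ≡ h s) →
             ∀ P → ∑[ i < n ] h (toℕ i + P) ≡ ∑[ i < n ] h (toℕ i)
∑-periodic n h periodic zero    = sum-cong-≗ {n} (λ i → cong h (+-identityʳ (toℕ i)))
∑-periodic n h periodic (suc P) = begin
  ∑[ i < n ] h (toℕ i + suc P)   ≡⟨ sum-cong-≗ {n} (λ i → cong h (+-suc (toℕ i) P)) ⟩
  ∑[ i < n ] h (suc (toℕ i) + P) ≡⟨ ∑-rotate₁ n (h ∘′ (_+ P)) (trans (cong h (+-comm n P)) (periodic P)) ⟩
  ∑[ i < n ] h (toℕ i + P)       ≡⟨ ∑-periodic n h periodic P ⟩
  ∑[ i < n ] h (toℕ i)           ∎
  where open ≡-Reasoning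

n≤∑ : ∀ n (f : Fin n → ℕ) → (∀ i → 1 ≤ f i) → n ≤ ∑[ i < n ] f i
n≤∑ zero    f positive = z≤n
n≤∑ (suc n) f positive = +-mono-≤ (positive zero) (n≤∑ n (f ∘′ suc) (λ i → positive (suc i)))

bit : Bool → ℕ
bit false = 0
bit true  = 1

∣p∣≡∑ : ∀ {n} (p : Subset n) → ∣ p ∣ ≡ ∑[ i < n ] bit (lookup p i)
∣p∣≡∑ []            = refl
∣p∣≡∑ (inside  ∷ p) = cong suc (∣p∣≡∑ p)
∣p∣≡∑ (outside ∷ p) = ∣p∣≡∑ p

∣p∣≡∑ˡ+∑ʳ : ∀ m {n} (p : Subset (m + n)) →
            ∣ p ∣ ≡ ∑[ i < m ] bit (lookup p (i ↑ˡ n)) + ∑[ j < n ] bit (lookup p (m ↑ʳ j))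
∣p∣≡∑ˡ+∑ʳ zero    p             = ∣p∣≡∑ p
∣p∣≡∑ˡ+∑ʳ (suc m) (inside  ∷ p) = cong suc (∣p∣≡∑ˡ+∑ʳ m p)
∣p∣≡∑ˡ+∑ʳ (suc m) (outside ∷ p) = ∣p∣≡∑ˡ+∑ʳ m p

∣p++q∣ : ∀ {m n} (p : Subset m) (q : Subset n) → ∣ p ++ q ∣ ≡ ∣ p ∣ + ∣ q ∣
∣p++q∣ []            q = refl
∣p++q∣ (inside  ∷ p) q = cong suc (∣p++q∣ p q)
∣p++q∣ (outside ∷ p) q = ∣p++q∣ p q

∈-++⁺ˡ : ∀ {m n} {p : Subset m} (q : Subset n) {i} → i ∈ p → (i ↑ˡ n) ∈ p ++ q
∈-++⁺ˡ q here        = here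
∈-++⁺ˡ q (there i∈p) = there (∈-++⁺ˡ q i∈p)

∈-++⁺ʳ : ∀ {m n} (p : Subset m) {q : Subset n} {j} → j ∈ q → (m ↑ʳ j) ∈ p ++ q
∈-++⁺ʳ []      j∈q = j∈q
∈-++⁺ʳ (_ ∷ p) j∈q = there (∈-++⁺ʳ p j∈q)

lookup≡false⇒∉ : ∀ {n} {p : Subset n} {i} → lookup p i ≡ false → i ∉ p
lookup≡false⇒∉ i∉p i∈p with () ← trans (sym ([]=⇒lookup i∈p)) i∉p

-- Counting along the cycle

module _ {c R : ℕ} where

  covered-bound : ∀ x y → c ≤ bit (x ∨ y) + R → suc c ≤ bit x + ((bit true + bit y) + R)
  covered-bound true  y c≤ = s≤s (≤-trans c≤ (s≤s (m≤n+m R (bit y))))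
  covered-bound false y c≤ = s≤s c≤

  gap-bound : ∀ x y → x ∨ y ≡ true → c ≤ R → suc c ≤ bit x + ((bit false + bit y) + R)
  gap-bound true  y    _ c≤ = s≤s (≤-trans c≤ (m≤n+m R (bit y)))
  gap-bound false true _ c≤ = s≤s c≤

module _ (a b : ℕ → Bool) where

  weight : ℕ → ℕ
  weight s = bit (b s) + bit (a s)

  1≤weight : ∀ s → b s ≡ true → 1 ≤ weight s
  1≤weight s bs rewrite bs = s≤s z≤n

module _ (a b : ℕ → Bool)
  (gap : ∀ {q P} → q < P → b q ≡ false → b P ≡ false → ¬ (∀ s → q < s → s ≤ P → a s ≡ false)) where

  private
    Unseen : Bool → ℕ → ℕ → Set
    Unseen seen q P = seen ≡ false → ∀ s → q < s → s < P → a s ≡ false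

    extend : ∀ {seen q P} → seen ∨ a P ≡ false → Unseen seen q P → ∀ s → q < s → s ≤ P → a s ≡ false
    extend {seen} unseen′ unseen s q<s s≤P with m≤n⇒m<n∨m≡n s≤P
    ... | inj₁ s<P  = unseen (∨-conicalˡ seen _ unseen′) s q<s s<P
    ... | inj₂ refl = ∨-conicalʳ seen _ unseen′

    shifted : ∀ {x} c P → c ≤ x + ∑[ i < c ] weight a b (toℕ i + suc P) →
                          c ≤ x + ∑[ i < c ] weight a b (suc (toℕ i + P))
    shifted {x} c P = subst (λ R → c ≤ x + R) (sum-cong-≗ {c} (λ i → cong (weight a b) (+-suc (toℕ i) P)))

  -- Think of a s and b s as "v_s ∈ S" and "u_s ∈ S". Reading positions P, P+1, …, each missing
  -- tip u_P is paid for by some v_s ∈ S with q < s ≤ P, where q is the previous missing tip;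
  -- seen records whether such a v_s has been read already.
  scan : ∀ c {q P} seen → q < P → b q ≡ false → Unseen seen q P →
         c ≤ bit seen + ∑[ i < c ] weight a b (toℕ i + P)
  scan zero    _ _ _ _ = z≤n
  scan (suc c) {q} {P} seen q<P bq≡false unseen with b P in bP | seen ∨ a P in seen′
  ... | true  | _     = covered-bound seen (a P) (shifted c P (scan c (seen ∨ a P) (m<n⇒m<1+n q<P) bq≡false
      λ e s q<s s<1+P → extend e unseen s q<s (s≤s⁻¹ s<1+P)))
  ... | false | true  = gap-bound seen (a P) seen′ (shifted c P (scan c false (n<1+n P) bP
      λ _ s P<s s<1+P → ⊥-elim (<⇒≱ P<s (s≤s⁻¹ s<1+P))))
  ... | false | false = ⊥-elim (gap q<P bq≡false bP (extend seen′ unseen))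

-- Forts

module _ {n : ℕ} (G : Graph n) where

  IsFort : (Fin n → Set) → Set
  IsFort F = ∀ x y → ¬ F x → Adj G x y → F y → Σ (Fin n) λ z → Adj G x z × F z × z ≢ y

  blue-avoids-fort : ∀ {S F} → IsFort F → (∀ x → F x → x ∉ S) → ∀ {x} → Blue G S x → ¬ F x
  blue-avoids-fort fort S∩F≡∅ (initial x∈S) x∈F = S∩F≡∅ _ x∈F x∈S
  blue-avoids-fort fort S∩F≡∅ (force {u} {x} u-blue u~x others) x∈F
    with fort u x (blue-avoids-fort fort S∩F≡∅ u-blue) u~x x∈F
  ... | z , u~z , z∈F , z≢x = blue-avoids-fort fort S∩F≡∅ (others z u~z z≢x) z∈F

-- The sun graph

data SunVertex (k : ℕ) : Fin (k + k) → Set where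
  cycle : (i : Fin k) → SunVertex k (vtx i)
  tip   : (i : Fin k) → SunVertex k (utx i)

sunVertex : ∀ k (x : Fin (k + k)) → SunVertex k x
sunVertex k x with splitAt k {k} x in eq
... | inj₁ i = subst (SunVertex k) (splitAt⁻¹-↑ˡ eq) (cycle i)
... | inj₂ i = subst (SunVertex k) (splitAt⁻¹-↑ʳ eq) (tip i)

module _ {k : ℕ} where

  vv-adj : ∀ i j → (j ≡ csuc i) ⊎ (i ≡ csuc j) → Adj (Sun k) (vtx i) (vtx j)
  vv-adj i j a rewrite splitAt-↑ˡ k i k | splitAt-↑ˡ k j k = a

  adj-vv : ∀ i j → Adj (Sun k) (vtx i) (vtx j) → (j ≡ csuc i) ⊎ (i ≡ csuc j)
  adj-vv i j a rewrite splitAt-↑ˡ k i k | splitAt-↑ˡ k j k = a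

  vu-adj : ∀ i j → (i ≡ j) ⊎ (i ≡ csuc j) → Adj (Sun k) (vtx i) (utx j)
  vu-adj i j a rewrite splitAt-↑ˡ k i k | splitAt-↑ʳ k k j = a

  adj-vu : ∀ i j → Adj (Sun k) (vtx i) (utx j) → (i ≡ j) ⊎ (i ≡ csuc j)
  adj-vu i j a rewrite splitAt-↑ˡ k i k | splitAt-↑ʳ k k j = a

  uv-adj : ∀ i j → (j ≡ i) ⊎ (j ≡ csuc i) → Adj (Sun k) (utx i) (vtx j)
  uv-adj i j a rewrite splitAt-↑ʳ k k i | splitAt-↑ˡ k j k = a

  adj-uv : ∀ i j → Adj (Sun k) (utx i) (vtx j) → (j ≡ i) ⊎ (j ≡ csuc i)
  adj-uv i j a rewrite splitAt-↑ʳ k k i | splitAt-↑ˡ k j k = a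

  ¬adj-uu : ∀ i j → ¬ Adj (Sun k) (utx i) (utx j)
  ¬adj-uu i j a rewrite splitAt-↑ʳ k k i | splitAt-↑ʳ k k j = a

  vtx-injective : ∀ {i j : Fin k} → vtx i ≡ vtx j → i ≡ j
  vtx-injective = ↑ˡ-injective k _ _

  utx-injective : ∀ {i j : Fin k} → utx i ≡ utx j → i ≡ j
  utx-injective = ↑ʳ-injective k _ _

  vtx≢utx : ∀ {i j : Fin k} → vtx i ≢ utx j
  vtx≢utx {i} {j} eq with () ← trans (sym (splitAt-↑ˡ k i k)) (trans (cong (splitAt k) eq) (splitAt-↑ʳ k k j))

module _ {m : ℕ} where

  private
    k : ℕ
    k = suc (suc m)

  v[_] u[_] : ℕ → Fin (k + k)
  v[ s ] = vtx {k} (pos s)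
  u[ s ] = utx {k} (pos s)

  ArcFort : ℕ → ℕ → Fin (k + k) → Set
  ArcFort q P x = x ≡ u[ q ] ⊎ x ≡ u[ P ] ⊎ ∃[ s ] q < s × s ≤ P × x ≡ v[ s ]

  private
    Escape : ℕ → ℕ → Fin (k + k) → Fin (k + k) → Set
    Escape q P x y = Σ (Fin (k + k)) λ z → Adj (Sun k) x z × ArcFort q P z × z ≢ y

    tip-escape : ∀ {q P} (t : Fin k) y → ¬ ArcFort q P (utx t) → Adj (Sun k) (utx t) y → ArcFort q P y →
                 Escape q P (utx t) y
    tip-escape t _ _ t~y (inj₁ refl)        = ⊥-elim (¬adj-uu _ _ t~y)
    tip-escape t _ _ t~y (inj₂ (inj₁ refl)) = ⊥-elim (¬adj-uu _ _ t~y)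
    tip-escape t _ t∉F t~y (inj₂ (inj₂ (suc s , q<1+s , s<P , refl))) with adj-uv t (pos (suc s)) t~y
    ... | inj₁ e with m≤n⇒m<n∨m≡n s<P
    ...   | inj₂ refl  = ⊥-elim (t∉F (inj₂ (inj₁ (cong utx (sym e)))))
    ...   | inj₁ 1+s<P =
      v[ suc (suc s) ] , uv-adj t _ (inj₂ (cong csuc e)) ,
      inj₂ (inj₂ (suc (suc s) , m<n⇒m<1+n q<1+s , 1+s<P , refl)) , csuc-irreflexive _ ∘ vtx-injective
    tip-escape t _ t∉F t~y (inj₂ (inj₂ (suc s , q<1+s , s<P , refl))) | inj₂ e
      with m≤n⇒m<n∨m≡n (s≤s⁻¹ q<1+s) | csuc-injective {i = pos s} {t} e
    ... | inj₂ refl | refl = ⊥-elim (t∉F (inj₁ refl))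
    ... | inj₁ q<s  | refl =
      v[ s ] , uv-adj _ _ (inj₁ refl) , inj₂ (inj₂ (s , q<s , <⇒≤ s<P , refl)) ,
      csuc-irreflexive _ ∘ sym ∘ vtx-injective

    cycle-escape : ∀ {q P} (t : Fin k) y → q < P → ¬ ArcFort q P (vtx t) → Adj (Sun k) (vtx t) y →
                   ArcFort q P y → Escape q P (vtx t) y
    cycle-escape {q} {P} t _ q<P t∉F t~y (inj₁ refl) with adj-vu t (pos q) t~y
    ... | inj₁ refl =
      v[ suc q ] , vv-adj (pos q) (pos (suc q)) (inj₁ refl) , inj₂ (inj₂ (suc q , n<1+n q , q<P , refl)) , vtx≢utx
    ... | inj₂ e    = ⊥-elim (t∉F (inj₂ (inj₂ (suc q , n<1+n q , q<P , cong vtx e))))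
    cycle-escape {q} {P} t _ q<P t∉F t~y (inj₂ (inj₁ refl)) with adj-vu t (pos P) t~y
    ... | inj₁ e = ⊥-elim (t∉F (inj₂ (inj₂ (P , q<P , ≤-refl , cong vtx e))))
    ... | inj₂ e = v[ P ] , vv-adj t (pos P) (inj₂ e) , inj₂ (inj₂ (P , q<P , ≤-refl , refl)) , vtx≢utx
    cycle-escape {q} {P} t _ q<P t∉F t~y (inj₂ (inj₂ (suc s , q<1+s , s<P , refl))) with adj-vv t (pos (suc s)) t~y
    ... | inj₁ e with m≤n⇒m<n∨m≡n (s≤s⁻¹ q<1+s) | csuc-injective {i = pos s} {t} e
    ...   | inj₂ refl | refl = u[ q ] , vu-adj _ _ (inj₁ refl) , inj₁ refl , vtx≢utx ∘ sym
    ...   | inj₁ q<s  | refl = ⊥-elim (t∉F (inj₂ (inj₂ (s , q<s , <⇒≤ s<P , refl))))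
    cycle-escape {q} {P} t _ q<P t∉F t~y (inj₂ (inj₂ (suc s , q<1+s , s<P , refl))) | inj₂ e
      with m≤n⇒m<n∨m≡n s<P
    ... | inj₂ refl  = u[ P ] , vu-adj _ _ (inj₂ e) , inj₂ (inj₁ refl) , vtx≢utx ∘ sym
    ... | inj₁ 1+s<P = ⊥-elim (t∉F (inj₂ (inj₂ (suc (suc s) , m<n⇒m<1+n q<1+s , 1+s<P , cong vtx e))))

  arcFort-isFort : ∀ {q P} → q < P → IsFort (Sun k) (ArcFort q P)
  arcFort-isFort q<P x y x∉F x~y y∈F with sunVertex k x
  ... | cycle t = cycle-escape t y q<P x∉F x~y y∈F
  ... | tip t   = tip-escape t y x∉F x~y y∈F

  module _ (S : Subset (k + k)) where

    v∈ᵇS u∈ᵇS : ℕ → Bool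
    v∈ᵇS s = lookup S v[ s ]
    u∈ᵇS s = lookup S u[ s ]

    private
      cell-weight : Fin k → ℕ
      cell-weight i = bit (lookup S (utx {k} i)) + bit (lookup S (vtx {k} i))

    ∣S∣≡∑weight : ∣ S ∣ ≡ ∑[ i < k ] weight v∈ᵇS u∈ᵇS (toℕ i)
    ∣S∣≡∑weight = begin
      ∣ S ∣                                    ≡⟨ ∣p∣≡∑ˡ+∑ʳ k S ⟩
      sum (bit ∘ vᵢ∈S) + sum (bit ∘ uᵢ∈S)      ≡⟨ +-comm (sum (bit ∘ vᵢ∈S)) _ ⟩
      sum (bit ∘ uᵢ∈S) + sum (bit ∘ vᵢ∈S)      ≡⟨ ∑-distrib-+ (bit ∘ uᵢ∈S) (bit ∘ vᵢ∈S) ⟨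
      ∑[ i < k ] cell-weight i                 ≡⟨ sum-cong-≗ {k} (λ i → cong cell-weight (pos-toℕ i)) ⟨
      ∑[ i < k ] cell-weight (pos (toℕ i))     ∎
      where
      open ≡-Reasoning
      vᵢ∈S uᵢ∈S : Fin k → Bool
      vᵢ∈S i = lookup S (vtx i)
      uᵢ∈S i = lookup S (utx i)

    weight-periodic : ∀ s → weight v∈ᵇS u∈ᵇS (s + k) ≡ weight v∈ᵇS u∈ᵇS s
    weight-periodic s = cong cell-weight (pos-periodic s)

    zfs-meets-arc : ZeroForcingSet (Sun k) S → ∀ {q P} → q < P → u∈ᵇS q ≡ false → u∈ᵇS P ≡ false →
                      ¬ (∀ s → q < s → s ≤ P → v∈ᵇS s ≡ false)
    zfs-meets-arc zfs {q} {P} q<P uq∉S uP∉S no-v =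
      blue-avoids-fort (Sun k) (arcFort-isFort q<P) fort∩S≡∅ (zfs u[ q ]) (inj₁ refl)
      where
      fort∩S≡∅ : ∀ x → ArcFort q P x → x ∉ S
      fort∩S≡∅ _ (inj₁ refl)                           = lookup≡false⇒∉ uq∉S
      fort∩S≡∅ _ (inj₂ (inj₁ refl))                    = lookup≡false⇒∉ uP∉S
      fort∩S≡∅ _ (inj₂ (inj₂ (s , q<s , s≤P , refl))) = lookup≡false⇒∉ (no-v s q<s s≤P)

    k≤∣S∣ : ZeroForcingSet (Sun k) S → k ≤ ∣ S ∣
    k≤∣S∣ zfs with any? (λ j → lookup S (utx {k} j) ≟ false)
    ... | yes (j , uⱼ∉S) = begin
      k                                                   ≤⟨ scan-from-j ⟩
      ∑[ i < k ] weight v∈ᵇS u∈ᵇS (toℕ i + suc (toℕ j)) ≡⟨ ∑-periodic k _ weight-periodic (suc (toℕ j)) ⟩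
      ∑[ i < k ] weight v∈ᵇS u∈ᵇS (toℕ i)               ≡⟨ ∣S∣≡∑weight ⟨
      ∣ S ∣                                               ∎
      where
      open ≤-Reasoning
      uⱼ∉S′ : u∈ᵇS (toℕ j) ≡ false
      uⱼ∉S′ = trans (cong (lookup S ∘ utx {k}) (pos-toℕ j)) uⱼ∉S
      scan-from-j : k ≤ ∑[ i < k ] weight v∈ᵇS u∈ᵇS (toℕ i + suc (toℕ j))
      scan-from-j = scan v∈ᵇS u∈ᵇS (zfs-meets-arc zfs) k false (n<1+n (toℕ j)) uⱼ∉S′
        λ _ s j<s s≤j → ⊥-elim (<⇒≱ j<s (s≤s⁻¹ s≤j))
    ... | no none = subst (k ≤_) (sym ∣S∣≡∑weight)
      (n≤∑ k _ λ i → 1≤weight v∈ᵇS u∈ᵇS (toℕ i) (¬-not λ uᵢ∉S → none (pos (toℕ i) , uᵢ∉S)))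

  private
    i₁ : Fin k
    i₁ = pos 1

  S₀ : Subset (k + k)
  S₀ = ⁅ i₁ ⁆ ++ (outside ∷ ⊤)

  ∣S₀∣≡k : ∣ S₀ ∣ ≡ k
  ∣S₀∣≡k = trans (∣p++q∣ ⁅ i₁ ⁆ (outside ∷ ⊤)) (cong₂ _+_ (∣⁅x⁆∣≡1 i₁) (∣⊤∣≡n (suc m)))

  private
    utx∈S₀ : ∀ {j : Fin k} → j ≢ zero → utx {k} j ∈ S₀
    utx∈S₀ {zero}  j≢0 = ⊥-elim (j≢0 refl)
    utx∈S₀ {suc j} _   = ∈-++⁺ʳ ⁅ i₁ ⁆ (there ∈⊤)

    blue-cycle : ∀ t → t < k → Blue (Sun k) S₀ v[ suc t ]
    blue-cycle zero    _  = initial (∈-++⁺ˡ (outside ∷ ⊤) (x∈⁅x⁆ i₁))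
    blue-cycle (suc t) lt = force {u = u[ suc t ]}
      (initial (utx∈S₀ λ e → 1+n≢0 (trans (sym (toℕ-pos lt)) (cong toℕ e))))
      (uv-adj (pos (suc t)) (pos (suc (suc t))) (inj₂ refl))
      others
      where
      others : ∀ w → Adj (Sun k) u[ suc t ] w → w ≢ v[ suc (suc t) ] → Blue (Sun k) S₀ w
      others w u~w w≢target with sunVertex k w
      ... | tip j   = ⊥-elim (¬adj-uu _ j u~w)
      ... | cycle j with adj-uv (pos (suc t)) j u~w
      ...   | inj₁ refl = blue-cycle t (<-trans (n<1+n t) lt)
      ...   | inj₂ refl = ⊥-elim (w≢target refl)

    blue-vtx : ∀ (i : Fin k) → Blue (Sun k) S₀ (vtx {k} i)
    blue-vtx zero    = subst (Blue (Sun k) S₀ ∘ vtx {k}) (pos-periodic 0) (blue-cycle (suc m) (n<1+n _))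
    blue-vtx (suc j) = subst (Blue (Sun k) S₀ ∘ vtx {k}) (pos-toℕ (suc j))
                             (blue-cycle (toℕ j) (<-trans (toℕ<n j) (n<1+n _)))

    blue-utx : ∀ (j : Fin k) → Blue (Sun k) S₀ (utx {k} j)
    blue-utx (suc j) = initial (utx∈S₀ λ ())
    blue-utx zero    = force {u = vtx {k} zero} (blue-vtx zero) (vu-adj zero zero (inj₁ refl)) others
      where
      others : ∀ w → Adj (Sun k) (vtx {k} zero) w → w ≢ utx {k} zero → Blue (Sun k) S₀ w
      others w _ w≢u₀ with sunVertex k w
      ... | cycle i     = blue-vtx i
      ... | tip zero    = ⊥-elim (w≢u₀ refl)
      ... | tip (suc j) = blue-utx (suc j)

  S₀-isZeroForcingSet : ZeroForcingSet (Sun k) S₀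
  S₀-isZeroForcingSet x with sunVertex k x
  ... | cycle i = blue-vtx i
  ... | tip j   = blue-utx j

-- The weak dual

module _ {A : Set} where

  consec-tabulate-inject₁ : ∀ {n} (f : Fin (suc n) → A) z (i : Fin n) →
                            Consec (tabulate f ++ₗ [ z ]) (f (inject₁ i)) (f (suc i))
  consec-tabulate-inject₁ f z zero    = here
  consec-tabulate-inject₁ f z (suc i) = there (consec-tabulate-inject₁ (f ∘ suc) z i)

  consec-tabulate-fromℕ : ∀ {n} (f : Fin (suc n) → A) z → Consec (tabulate f ++ₗ [ z ]) (f (fromℕ n)) z
  consec-tabulate-fromℕ {zero}  f z = here
  consec-tabulate-fromℕ {suc n} f z = there (consec-tabulate-fromℕ (f ∘ suc) z)

  consec-tabulate-csuc : ∀ {n} (f : Fin (suc n) → A) i →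
                         Consec (tabulate f ++ₗ [ f zero ]) (f i) (f (csuc i))
  consec-tabulate-csuc {n} f i with view i
  ... | ‵fromℕ     = subst (Consec (tabulate f ++ₗ [ f zero ]) (f (fromℕ n)) ∘ f)
                           (sym csuc-fromℕ) (consec-tabulate-fromℕ f (f zero))
  ... | ‵inject₁ j = subst (Consec (tabulate f ++ₗ [ f zero ]) (f (inject₁ j)) ∘ f)
                           (sym (csuc-inject₁ j)) (consec-tabulate-inject₁ f (f zero) j)

module _ {m : ℕ} where

  private
    k : ℕ
    k = suc (suc (suc m))

    Dual : Graph (suc k)
    Dual = WeakDual (Sun k) (SunFaces k)

    Spoke Rim : Fin k → Fin (k + k) → Fin (k + k) → Set
    Spoke i a b = a ≡ utx {k} i ⊎ b ≡ utx {k} i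
    Rim i a b = (a ≡ vtx {k} i × b ≡ vtx {k} (csuc i)) ⊎ (a ≡ vtx {k} (csuc i) × b ≡ vtx {k} i)

    triangle-edge : ∀ i {a b} → CycEdge (boundary (SunFaces k) (suc i)) a b → Spoke i a b ⊎ Rim i a b
    triangle-edge i (inj₁ here)                                = inj₁ (inj₂ refl)
    triangle-edge i (inj₁ (there here))                        = inj₁ (inj₁ refl)
    triangle-edge i (inj₁ (there (there here)))                = inj₂ (inj₂ (refl , refl))
    triangle-edge i (inj₁ (there (there (there (there ())))))
    triangle-edge i (inj₂ here)                                = inj₁ (inj₁ refl)
    triangle-edge i (inj₂ (there here))                        = inj₁ (inj₂ refl)
    triangle-edge i (inj₂ (there (there here)))                = inj₂ (inj₁ (refl , refl))
    triangle-edge i (inj₂ (there (there (there (there ())))))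

    spoke-rim : ∀ {i j a b} → Spoke i a b → Rim j a b → ⊥
    spoke-rim (inj₁ a≡u) (inj₁ (a≡v , _)) = vtx≢utx {k} (trans (sym a≡v) a≡u)
    spoke-rim (inj₁ a≡u) (inj₂ (a≡v , _)) = vtx≢utx {k} (trans (sym a≡v) a≡u)
    spoke-rim (inj₂ b≡u) (inj₁ (_ , b≡v)) = vtx≢utx {k} (trans (sym b≡v) b≡u)
    spoke-rim (inj₂ b≡u) (inj₂ (_ , b≡v)) = vtx≢utx {k} (trans (sym b≡v) b≡u)

    spoke-spoke : ∀ {i j a b} → Adj (Sun k) a b → Spoke i a b → Spoke j a b → i ≡ j
    spoke-spoke a~b (inj₁ a≡uᵢ) (inj₁ a≡uⱼ) = utx-injective (trans (sym a≡uᵢ) a≡uⱼ)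
    spoke-spoke a~b (inj₂ b≡uᵢ) (inj₂ b≡uⱼ) = utx-injective (trans (sym b≡uᵢ) b≡uⱼ)
    spoke-spoke a~b (inj₁ a≡uᵢ) (inj₂ b≡uⱼ) = ⊥-elim (¬adj-uu _ _ (subst₂ (Adj (Sun k)) a≡uᵢ b≡uⱼ a~b))
    spoke-spoke a~b (inj₂ b≡uᵢ) (inj₁ a≡uⱼ) = ⊥-elim (¬adj-uu _ _ (subst₂ (Adj (Sun k)) a≡uⱼ b≡uᵢ a~b))

    rim-rim : ∀ {i j a b} → Rim i a b → Rim j a b → i ≡ j
    rim-rim (inj₁ (a≡vᵢ , _)) (inj₁ (a≡vⱼ , _)) = vtx-injective (trans (sym a≡vᵢ) a≡vⱼ)
    rim-rim (inj₂ (_ , b≡vᵢ)) (inj₂ (_ , b≡vⱼ)) = vtx-injective (trans (sym b≡vᵢ) b≡vⱼ)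
    rim-rim {i} {j} (inj₁ (a≡vᵢ , b≡vᵢ₊₁)) (inj₂ (a≡vⱼ₊₁ , b≡vⱼ)) = ⊥-elim (csuc²-irreflexive j (begin
      csuc (csuc j) ≡⟨ cong csuc (vtx-injective (trans (sym a≡vⱼ₊₁) a≡vᵢ)) ⟩
      csuc i        ≡⟨ vtx-injective (trans (sym b≡vᵢ₊₁) b≡vⱼ) ⟩
      j             ∎))
      where open ≡-Reasoning
    rim-rim rimᵢ@(inj₂ _) rimⱼ@(inj₁ _) = sym (rim-rim rimⱼ rimᵢ)

    triangles-share-no-edge : ∀ {i j a b} → Adj (Sun k) a b →
                              CycEdge (boundary (SunFaces k) (suc i)) a b →
                              CycEdge (boundary (SunFaces k) (suc j)) a b → i ≡ j
    triangles-share-no-edge {i} {j} a~b eᵢ eⱼ with triangle-edge i eᵢ | triangle-edge j eⱼ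
    ... | inj₁ spokeᵢ | inj₁ spokeⱼ = spoke-spoke a~b spokeᵢ spokeⱼ
    ... | inj₁ spokeᵢ | inj₂ rimⱼ   = ⊥-elim (spoke-rim spokeᵢ rimⱼ)
    ... | inj₂ rimᵢ   | inj₁ spokeⱼ = ⊥-elim (spoke-rim spokeⱼ rimᵢ)
    ... | inj₂ rimᵢ   | inj₂ rimⱼ   = rim-rim rimᵢ rimⱼ

    hub-edge : ∀ i → CycEdge (boundary (SunFaces k) zero) (vtx {k} i) (vtx {k} (csuc i))
    hub-edge i = inj₁ (subst (λ xs → Consec (xs ++ₗ [ vtx {k} zero ]) (vtx {k} i) (vtx {k} (csuc i)))
                             (sym (map-tabulate (λ j → j) (vtx {k}))) (consec-tabulate-csuc (vtx {k}) i))

    hub~triangle : ∀ i → Adj Dual zero (suc i)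
    hub~triangle i =
      (λ ()) , vtx {k} i , vtx {k} (csuc i) , vv-adj i (csuc i) (inj₁ refl) , hub-edge i , inj₂ (there (there here))

    triangle~hub : ∀ i → Adj Dual (suc i) zero
    triangle~hub i =
      (λ ()) , vtx {k} i , vtx {k} (csuc i) , vv-adj i (csuc i) (inj₁ refl) , inj₂ (there (there here)) , hub-edge i

    triangle-isLeaf : ∀ i → IsLeaf Dual (suc i)
    triangle-isLeaf i = zero , triangle~hub i , only-hub
      where
      only-hub : ∀ f → Adj Dual (suc i) f → f ≡ zero
      only-hub zero    _                              = refl
      only-hub (suc j) (i≢j , a , b , a~b , eᵢ , eⱼ) = ⊥-elim (i≢j (cong suc (triangles-share-no-edge a~b eᵢ eⱼ)))

    hub-¬isLeaf : ¬ IsLeaf Dual zero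
    hub-¬isLeaf (_ , _ , unique)
      with () ← trans (unique _ (hub~triangle zero)) (sym (unique _ (hub~triangle (suc zero))))

  sunDual-numLeaves : NumLeaves Dual k
  sunDual-numLeaves = outside ∷ ⊤ , (λ f → mk⇔ (leaf f) (∈leaves f)) , ∣⊤∣≡n k
    where
    leaf : ∀ f → f ∈ outside ∷ ⊤ → IsLeaf Dual f
    leaf zero    ()
    leaf (suc i) _ = triangle-isLeaf i
    ∈leaves : ∀ f → IsLeaf Dual f → f ∈ outside ∷ ⊤
    ∈leaves zero    hub-leaf = ⊥-elim (hub-¬isLeaf hub-leaf)
    ∈leaves (suc i) _        = there ∈⊤

n≡[n+n]/2 : ∀ n → n ≡ (n + n) / 2
n≡[n+n]/2 n = sym (trans (cong (_/ 2) (trans (cong (n +_) (sym (+-identityʳ n))) (*-comm 2 n))) (m*n/n≡m n 2))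

proposition6 : (k : ℕ) → 3 ≤ k →
    IsZeroForcingNumber (Sun k) k ×
    NumLeaves (WeakDual (Sun k) (SunFaces k)) k ×
    k ≡ (k + k) / 2
proposition6 (suc (suc (suc m))) (s≤s (s≤s (s≤s _))) =
  ((S₀ {suc m} , S₀-isZeroForcingSet , ∣S₀∣≡k) , k≤∣S∣) ,
  sunDual-numLeaves ,
  n≡[n+n]/2 _
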